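{- Let $n\geq 1$ and $\ell\geq 0$ be integers, and let $\mathcal{P}(\ell)=(f_1,\dots,f_{k})$ be a path of $k=n-\lceil n/2\rceil+\ell$ faces. Consider the path configuration $R(\ell)=(n,\dots,n,0,\dots,0)$ on $\mathcal{P}(\ell)$, consisting of $\ell$ entries equal to $n$ followed by $n-\lceil n/2\rceil$ entries equal to $0$. Then path-firing on $R(\ell)$ terminates uniquely: every sequence of path fires starting at $R(\ell)$ is finite and all maximal sequences end at the same path-stable configuration.
   Context: A path is a sequence of faces $(f_1,\dots,f_k)$ of the square grid with consecutive faces adjacent (sharing an edge). A path configuration $R$ assigns an integer weight $R_i$ to each $f_i$. A path fire is a move involving only consecutive faces of the path: if $R_i\geq R_{i+1}+2$ one may replace $(R_i,R_{i+1})$ by $(R_i-1,R_{i+1}+1)$, and if $R_{i+1}\geq R_i+2$ one may replace $(R_i,R_{i+1})$ by $(R_i+1,R_{i+1}-1)$. A path configuration is path-stable if no path fire is possible. -}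

module Defs where

open import Data.Nat using (ℕ; _∸_; ⌈_/2⌉)
open import Data.Integer using (ℤ; +_; _+_; _-_; _≤_)
open import Data.Vec using (Vec; []; _∷_; replicate; _++_)
open import Relation.Nullary using (¬_)
open import Relation.Binary.Construct.Closure.ReflexiveTransitive using (Star)
open import Induction.WellFounded using (Acc)
open import Data.Product using (Σ; _×_)
open import Relation.Binary.PropositionalEquality using (_≡_)

-- A path configuration on a path of k faces: weights R_1..R_k.
-- (Only adjacency of consecutive faces matters for path fires.)
Config : ℕ → Set
Config k = Vec ℤ k

data Fire : {k : ℕ} → Config k → Config k → Set where
  fire-right : ∀ {k} (x y : ℤ) (xs : Config k) → y + + 2 ≤ x →
               Fire (x ∷ y ∷ xs) ((x - + 1) ∷ (y + + 1) ∷ xs)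
  fire-left  : ∀ {k} (x y : ℤ) (xs : Config k) → x + + 2 ≤ y →
               Fire (x ∷ y ∷ xs) ((x + + 1) ∷ (y - + 1) ∷ xs)
  there      : ∀ {k} (x : ℤ) {xs ys : Config k} → Fire xs ys → Fire (x ∷ xs) (x ∷ ys)

Fires : {k : ℕ} → Config k → Config k → Set
Fires = Star Fire

PathStable : {k : ℕ} → Config k → Set
PathStable R = ∀ T → ¬ Fire R T

Terminates : {k : ℕ} → Config k → Set
Terminates R = Acc (λ T S → Fire S T) R

TerminatesUniquely : {k : ℕ} → Config k → Set
TerminatesUniquely {k} R =
  Terminates R ×
  Σ (Config k) (λ S → Fires R S × PathStable S ×
     (∀ T → Fires R T → PathStable T → T ≡ S))

R : (n ℓ : ℕ) → Config (ℓ Data.Nat.+ (n ∸ ⌈ n /2⌉))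
R n ℓ = replicate ℓ (+ n) ++ replicate (n ∸ ⌈ n /2⌉) (+ 0)

{-# OPTIONS --safe #-}
module Submission where

-- Each fire moves one unit across a gap of at least 2 and so lowers the sum of
-- squares of the weights: firing terminates from every configuration. From a
-- nonincreasing configuration such as R n ℓ only downhill fires are possible
-- and the configuration stays nonincreasing; there two distinct fires always
-- commute (each stays possible after the other), so by Newman's lemma firing
-- is confluent and its path-stable end configuration is unique.

open import Defs
open import Data.Nat using (ℕ; _≥_)
import Data.Nat as ℕ
import Data.Nat.Induction as ℕ
import Data.Nat.Properties as ℕ
open import Data.Integer using (ℤ; +_; +[1+_]; -[1+_]; _+_; _-_; _*_; _≤_; _<_; _≤?_; -_; +≤+; +<+; ∣_∣; 0ℤ)
open import Data.Integer.Properties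
open import Data.Integer.Tactic.RingSolver using (solve-∀)
open import Data.Vec using ([]; _∷_; head; replicate; _++_)
open import Data.Vec.Relation.Unary.All using (All; []; _∷_)
open import Data.Vec.Relation.Unary.All.Properties using (++⁺)
open import Data.Vec.Relation.Unary.Linked using (Linked; []; [-]; _∷_)
open import Data.Empty using (⊥-elim)
open import Data.Product using (∃; _×_; _,_; curry; map; map₂; swap)
open import Function using (flip)
open import Relation.Nullary using (¬_; Dec; yes; no)
open import Relation.Binary.PropositionalEquality using (_≡_; subst; subst₂; sym)
open import Relation.Binary.Construct.Closure.ReflexiveTransitive using (Star; ε; _◅_; gmap)
open import Relation.Binary.Construct.Closure.Transitive using (Plus; [_]; _∼⁺⟨_⟩_)
open import Relation.Binary.Construct.Closure.Equivalence.Properties using (a—↠b&a—↠c⇒b↔c)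
open import Relation.Binary.Rewriting using (WeaklyNormalizing; HasNormalForm; IsNormalForm;
  StronglyNormalizing; WeaklyConfluent; Confluent; sn&wcr⇒cr; conf⇒unf)
open import Induction.WellFounded using (WellFounded; Acc; acc; module Subrelation)
import Relation.Binary.Construct.On as On

sumOfSquares : ∀ {k} → Config k → ℤ
sumOfSquares []       = 0ℤ
sumOfSquares (x ∷ xs) = x * x + sumOfSquares xs

sumOfSquares-nonneg : ∀ {k} (S : Config k) → 0ℤ ≤ sumOfSquares S
sumOfSquares-nonneg []       = ≤-refl
sumOfSquares-nonneg (x ∷ xs) = +-mono-≤ (x*x≥0 x) (sumOfSquares-nonneg xs)
  where
  x*x≥0 : ∀ x → 0ℤ ≤ x * x
  x*x≥0 (+ ℕ.zero)  = ≤-refl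
  x*x≥0 +[1+ n ]    = +≤+ ℕ.z≤n
  x*x≥0 -[1+ n ]    = +≤+ ℕ.z≤n

i<i+j : ∀ i {j} → 0ℤ < j → i < i + j
i<i+j i 0<j = subst (_< i + _) (+-identityʳ i) (+-monoʳ-< i 0<j)

transfer-sumOfSquares : ∀ x y s → x * x + (y * y + s) ≡
  ((x - + 1) * (x - + 1) + ((y + + 1) * (y + + 1) + s)) + (+ 2 + ((x - (y + + 2)) + (x - (y + + 2))))
transfer-sumOfSquares = solve-∀

transfer-decreases : ∀ x y s → y + + 2 ≤ x →
  (x - + 1) * (x - + 1) + ((y + + 1) * (y + + 1) + s) < x * x + (y * y + s)
transfer-decreases x y s p =
  subst (after <_) (sym (transfer-sumOfSquares x y s)) (i<i+j after 0<drop)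
  where
  after : ℤ
  after = (x - + 1) * (x - + 1) + ((y + + 1) * (y + + 1) + s)
  gap : 0ℤ ≤ x - (y + + 2)
  gap = i≤j⇒0≤j-i p
  0<drop : 0ℤ < + 2 + (x - (y + + 2) + (x - (y + + 2)))
  0<drop = +-mono-<-≤ (+<+ (ℕ.s≤s ℕ.z≤n)) (+-mono-≤ gap gap)

fire-decreases-sumOfSquares : ∀ {k} {S T : Config k} → Fire S T → sumOfSquares T < sumOfSquares S
fire-decreases-sumOfSquares (fire-right x y xs p) = transfer-decreases x y (sumOfSquares xs) p
fire-decreases-sumOfSquares (fire-left x y xs q) =
  subst₂ _<_ (swap-squares (y - + 1) (x + + 1) s) (swap-squares y x s) (transfer-decreases y x s q)
  where
  s = sumOfSquares xs
  swap-squares : ∀ a b s → a * a + (b * b + s) ≡ b * b + (a * a + s)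
  swap-squares = solve-∀
fire-decreases-sumOfSquares (there x f) = +-monoʳ-< (x * x) (fire-decreases-sumOfSquares f)

∣∣-mono-<-nonneg : ∀ {i j} → 0ℤ ≤ i → i < j → ∣ i ∣ ℕ.< ∣ j ∣
∣∣-mono-<-nonneg (+≤+ _) (+<+ i<j) = i<j

energy : ∀ {k} → Config k → ℕ
energy S = ∣ sumOfSquares S ∣

fire-decreases-energy : ∀ {k} {S T : Config k} → Fire S T → energy T ℕ.< energy S
fire-decreases-energy {T = T} f = ∣∣-mono-<-nonneg (sumOfSquares-nonneg T) (fire-decreases-sumOfSquares f)

fire-wellFounded : ∀ {k} → WellFounded (flip (Fire {k}))
fire-wellFounded = Subrelation.wellFounded fire-decreases-energy (On.wellFounded energy ℕ.<-wellFounded)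

fire? : ∀ {k} (S : Config k) → Dec (∃ (Fire S))
fire? []           = no λ ()
fire? (x ∷ [])     = no λ { (_ , there _ ()) }
fire? (x ∷ y ∷ xs) with y + + 2 ≤? x | x + + 2 ≤? y | fire? (y ∷ xs)
... | yes p | _     | _            = yes (_ , fire-right x y xs p)
... | no _  | yes q | _            = yes (_ , fire-left x y xs q)
... | no _  | no _  | yes (_ , f)  = yes (_ , there x f)
... | no ¬p | no ¬q | no ¬f        = no λ
  { (_ , fire-right _ _ _ p) → ¬p p
  ; (_ , fire-left _ _ _ q)  → ¬q q
  ; (_ , there _ f)          → ¬f (_ , f) }

fire-weaklyNormalizing : ∀ {k} → WeaklyNormalizing (Fire {k})
fire-weaklyNormalizing S = go (fire-wellFounded S)
  where
  go : ∀ {S} → Acc (flip Fire) S → HasNormalForm Fire S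
  go {S} (acc rs) with fire? S
  ... | no stable   = S , stable , ε
  ... | yes (_ , f) = map₂ (map₂ (f ◅_)) (go (rs f))

Nonincreasing : ∀ {k} → Config k → Set
Nonincreasing = Linked (flip _≤_)

≤⇒¬fire-left : ∀ {x y} → y ≤ x → ¬ (x + + 2 ≤ y)
≤⇒¬fire-left {x} y≤x x+2≤y = i≮i (<-≤-trans (i<i+j x (+<+ (ℕ.s≤s ℕ.z≤n))) (≤-trans x+2≤y y≤x))

fire-right-keeps-order : ∀ {x y} → y + + 2 ≤ x → y + + 1 ≤ x - + 1
fire-right-keeps-order {x} {y} p = subst (_≤ x - + 1) (y+2-1≡y+1 y) (+-monoˡ-≤ (- + 1) p)
  where
  y+2-1≡y+1 : ∀ y → y + + 2 - + 1 ≡ y + + 1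
  y+2-1≡y+1 = solve-∀

fire-head-≤ : ∀ {k} {S T : Config (ℕ.suc k)} → Nonincreasing S → Fire S T → head T ≤ head S
fire-head-≤ _         (fire-right x y xs p) = i-j≤i x (+ 1)
fire-head-≤ (y≤x ∷ _) (fire-left x y xs q)  = ⊥-elim (≤⇒¬fire-left y≤x q)
fire-head-≤ _         (there x f)           = ≤-refl

fire-preserves-nonincreasing : ∀ {k} {S T : Config k} → Nonincreasing S → Fire S T → Nonincreasing T
fire-preserves-nonincreasing (_ ∷ ni) (fire-right x y xs p) = fire-right-keeps-order {x} {y} p ∷ raise-head ni
  where
  raise-head : ∀ {k} {xs : Config k} → Nonincreasing (y ∷ xs) → Nonincreasing (y + + 1 ∷ xs)
  raise-head [-]        = [-]
  raise-head (z≤y ∷ ni) = ≤-trans z≤y (i≤i+j y (+ 1)) ∷ ni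
fire-preserves-nonincreasing (y≤x ∷ _) (fire-left x y xs q) = ⊥-elim (≤⇒¬fire-left y≤x q)
fire-preserves-nonincreasing (h ∷ ni) (there x f) =
  ≤-trans (fire-head-≤ ni f) h ∷ fire-preserves-nonincreasing ni f

Joinable : ∀ {k} → Config k → Config k → Set
Joinable A B = ∃ λ D → Fires A D × Fires B D

fire-right-joinable : ∀ {k x y} {xs : Config k} {B} → Nonincreasing (x ∷ y ∷ xs) → y + + 2 ≤ x →
  Fire (x ∷ y ∷ xs) B → Joinable (x - + 1 ∷ y + + 1 ∷ xs) B
fire-right-joinable _ _ (fire-right _ _ _ _) = _ , ε , ε
fire-right-joinable (y≤x ∷ _) _ (fire-left _ _ _ q) = ⊥-elim (≤⇒¬fire-left y≤x q)
fire-right-joinable (_ ∷ z≤y ∷ _) _ (there _ (fire-left _ _ _ q)) = ⊥-elim (≤⇒¬fire-left z≤y q)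
fire-right-joinable {x = x} {y} _ p (there _ (fire-right _ z zs q)) =
  _ , there (x - + 1) (fire-right (y + + 1) z zs (≤-trans q (i≤i+j y (+ 1)))) ◅ ε
    , subst (λ w → Fire (x ∷ y - + 1 ∷ z + + 1 ∷ zs) (x - + 1 ∷ w ∷ z + + 1 ∷ zs))
            (y-1+1≡y+1-1 y) (fire-right x (y - + 1) (z + + 1 ∷ zs) y-1+2≤x) ◅ ε
  where
  y-1+1≡y+1-1 : ∀ y → y - + 1 + + 1 ≡ y + + 1 - + 1
  y-1+1≡y+1-1 = solve-∀
  y-1+2≡y+2-1 : ∀ y → y - + 1 + + 2 ≡ y + + 2 - + 1
  y-1+2≡y+2-1 = solve-∀
  y-1+2≤x : y - + 1 + + 2 ≤ x
  y-1+2≤x = ≤-trans (≤-reflexive (y-1+2≡y+2-1 y)) (≤-trans (i-j≤i (y + + 2) (+ 1)) p)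
fire-right-joinable {x = x} {y} _ p (there _ (there _ {ys = ys} r)) =
  _ , there (x - + 1) (there (y + + 1) r) ◅ ε , fire-right x y ys p ◅ ε

fire-joinable : ∀ {k} {S A B : Config k} → Nonincreasing S → Fire S A → Fire S B → Joinable A B
fire-joinable ni (fire-right x y xs p) g = fire-right-joinable ni p g
fire-joinable ni f (fire-right x y xs p) = map₂ swap (fire-right-joinable ni p f)
fire-joinable (y≤x ∷ _) (fire-left _ _ _ q) _ = ⊥-elim (≤⇒¬fire-left y≤x q)
fire-joinable (y≤x ∷ _) _ (fire-left _ _ _ q) = ⊥-elim (≤⇒¬fire-left y≤x q)
fire-joinable (_ ∷ ni) (there x f) (there _ g) =
  map (x ∷_) (map (gmap (x ∷_) (there x)) (gmap (x ∷_) (there x))) (fire-joinable ni f g)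

NonincreasingFire : ∀ {k} → Config k → Config k → Set
NonincreasingFire S T = Nonincreasing S × Fire S T

fires-nonincreasing : ∀ {k} {S T : Config k} → Nonincreasing S → Fires S T → Star NonincreasingFire S T
fires-nonincreasing ni ε        = ε
fires-nonincreasing ni (f ◅ fs) = (ni , f) ◅ fires-nonincreasing (fire-preserves-nonincreasing ni f) fs

nonincreasingFire⁺-stronglyNormalizing : ∀ {k} → StronglyNormalizing (Plus (NonincreasingFire {k}))
nonincreasingFire⁺-stronglyNormalizing =
  Subrelation.wellFounded plus-decreases-energy (On.wellFounded energy ℕ.<-wellFounded)
  where
  plus-decreases-energy : ∀ {k} {S T : Config k} → Plus NonincreasingFire S T → energy T ℕ.< energy S
  plus-decreases-energy [ _ , f ]     = fire-decreases-energy f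
  plus-decreases-energy (_ ∼⁺⟨ p ⟩ q)     = ℕ.<-trans (plus-decreases-energy q) (plus-decreases-energy p)

nonincreasingFire-weaklyConfluent : ∀ {k} → WeaklyConfluent (NonincreasingFire {k})
nonincreasingFire-weaklyConfluent (ni , f) (_ , g) with fire-joinable ni f g
... | D , fs , gs = D , fires-nonincreasing (fire-preserves-nonincreasing ni f) fs
                      , fires-nonincreasing (fire-preserves-nonincreasing ni g) gs

nonincreasingFire-confluent : ∀ {k} → Confluent (NonincreasingFire {k})
nonincreasingFire-confluent =
  sn&wcr⇒cr nonincreasingFire⁺-stronglyNormalizing nonincreasingFire-weaklyConfluent

stable-unique : ∀ {k} {S T₁ T₂ : Config k} → Nonincreasing S →
  Fires S T₁ → PathStable T₁ → Fires S T₂ → PathStable T₂ → T₁ ≡ T₂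
stable-unique ni fs₁ st₁ fs₂ st₂ =
  conf⇒unf nonincreasingFire-confluent (normal st₁) (normal st₂)
    (a—↠b&a—↠c⇒b↔c (fires-nonincreasing ni fs₁) (fires-nonincreasing ni fs₂))
  where
  normal : ∀ {T} → PathStable T → IsNormalForm NonincreasingFire T
  normal st (T′ , _ , f) = st T′ f

all-replicate : ∀ {P : ℤ → Set} {a} m → P a → All P (replicate m a)
all-replicate ℕ.zero    _  = []
all-replicate (ℕ.suc m) pa = pa ∷ all-replicate m pa

∷-nonincreasing : ∀ {k x} {xs : Config k} → All (_≤ x) xs → Nonincreasing xs → Nonincreasing (x ∷ xs)
∷-nonincreasing []          _  = [-]
∷-nonincreasing (xs₀≤x ∷ _) ni = xs₀≤x ∷ ni

replicate-nonincreasing : ∀ {a} m → Nonincreasing (replicate m a)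
replicate-nonincreasing ℕ.zero    = []
replicate-nonincreasing (ℕ.suc m) = ∷-nonincreasing (all-replicate m ≤-refl) (replicate-nonincreasing m)

replicate-++-nonincreasing : ∀ {k a} {ys : Config k} → All (_≤ a) ys → Nonincreasing ys →
  ∀ ℓ → Nonincreasing (replicate ℓ a ++ ys)
replicate-++-nonincreasing _    ni ℕ.zero    = ni
replicate-++-nonincreasing ys≤a ni (ℕ.suc ℓ) =
  ∷-nonincreasing (++⁺ (all-replicate ℓ ≤-refl) ys≤a) (replicate-++-nonincreasing ys≤a ni ℓ)

R-nonincreasing : ∀ n ℓ → Nonincreasing (R n ℓ)
R-nonincreasing n ℓ =
  replicate-++-nonincreasing (all-replicate _ (+≤+ ℕ.z≤n)) (replicate-nonincreasing _) ℓ

theorem3p5 : (n ℓ : ℕ) → n ≥ 1 → TerminatesUniquely (R n ℓ)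
theorem3p5 n ℓ _ =
  let S , normal , reach = fire-weaklyNormalizing (R n ℓ)
      stable = curry normal
  in fire-wellFounded (R n ℓ) , S , reach , stable ,
     λ T fires stableT → stable-unique (R-nonincreasing n ℓ) fires stableT reach stable
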